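{- Let $\Gamma$ be a context, $P,P'\in\mathrm{Proc}(\Gamma)$, $a$ an action in $\Gamma$ and $R\in\mathrm{Proc}(\Gamma+|a|)$. Suppose $P\xrightarrow{a}R$ and $P\rtimes P'$ (generalised bound braid). Then there exists a process $R'\in\mathrm{Proc}(\Gamma+|a|)$ such that $P'\xrightarrow{a}R'$ and $R\rtimes R'$.
   Context: Synchronous $\pi$-calculus with de Bruijn indices. Contexts $\Gamma$ are natural numbers; a name in $\Gamma$ is a natural number $x<\Gamma$. The set $\mathrm{Proc}(\Gamma)$ of processes closed by $\Gamma$ is defined inductively: $\mathbf{0}\in\mathrm{Proc}(\Gamma)$; if $x<\Gamma$ and $P\in\mathrm{Proc}(\Gamma+1)$ then $\mathsf{in}\,x.P\in\mathrm{Proc}(\Gamma)$ (input on $x$, binding index $0$ in $P$); if $x,y<\Gamma$ and $P\in\mathrm{Proc}(\Gamma)$ then $\overline{x}\langle y\rangle.P\in\mathrm{Proc}(\Gamma)$; if $P,Q\in\mathrm{Proc}(\Gamma)$ then $P+Q$ and $P\mid Q$ are in $\mathrm{Proc}(\Gamma)$; if $P\in\mathrm{Proc}(\Gamma+1)$ then $\nu P\in\mathrm{Proc}(\Gamma)$; if $P\in\mathrm{Proc}(\Gamma)$ then $!P\in\mathrm{Proc}(\Gamma)$. Actions in $\Gamma$ are: bound actions $\mathsf{in}\,x$ (input) and $\overline{x}\langle\cdot\rangle$ (bound output) for $x<\Gamma$, and non-bound actions $\overline{x}\langle y\rangle$ (output) for $x,y<\Gamma$ and $\tau$. Set $|a|=1$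 if $a$ is bound and $|a|=0$ otherwise. A renaming $\rho:\Gamma\to\Delta$ is any function $\{0,\dots,\Gamma-1\}\to\{0,\dots,\Delta-1\}$. Its lifting $\rho+1:\Gamma+1\to\Delta+1$ maps $0\mapsto0$ and $x+1\mapsto\rho(x)+1$. Renamings act on actions by renaming every name ($\rho\tau=\tau$), and on processes by: $\rho\mathbf{0}=\mathbf{0}$, $\rho(\mathsf{in}\,x.P)=\mathsf{in}\,\rho(x).((\rho+1)P)$, $\rho(\overline{x}\langle y\rangle.P)=\overline{\rho x}\langle\rho y\rangle.\rho P$, $\rho(P+Q)=\rho P+\rho Q$, $\rho(P\mid Q)=\rho P\mid\rho Q$, $\rho(\nu P)=\nu((\rho+1)P)$, $\rho(!P)=!\rho P$. Special renamings: $\mathsf{push}:\Gamma\to\Gamma+1$, $x\mapsto x+1$; for $y<\Gamma$, $\mathsf{pop}\,y:\Gamma+1\to\Gamma$, $0\mapsto y$, $x+1\mapsto x$; $\mathsf{swap}:\Gamma+2\to\Gamma+2$ exchanging $0$ and $1$ and fixing all $x\ge2$. Transitions: for $P\in\mathrm{Proc}(\Gamma)$, an action $a$ in $\Gamma$ and $R\in\mathrm{Proc}(\Gamma+|a|)$, the relation $P\xrightarrow{a}R$ is the least relation closed under the following rules ($b$ ranges over bound actions, $c$ over non-bound actions): $\mathsf{in}\,x.P\xrightarrow{\mathsf{in}\,x}P$; $\overline{x}\langle y\rangle.P\xrightarrow{\overline{x}\langle y\rangle}P$; if $P\xrightarrow{a}R$ then $P+Q\xrightarrow{a}R$; if $Q\xrightarrow{a}S$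 then $P+Q\xrightarrow{a}S$; if $P\xrightarrow{c}R$ then $P\mid Q\xrightarrow{c}R\mid Q$; if $Q\xrightarrow{c}S$ then $P\mid Q\xrightarrow{c}P\mid S$; if $P\xrightarrow{b}R$ then $P\mid Q\xrightarrow{b}R\mid\mathsf{push}\,Q$; if $Q\xrightarrow{b}S$ then $P\mid Q\xrightarrow{b}\mathsf{push}\,P\mid S$; if $P\xrightarrow{\mathsf{in}\,x}R$ and $Q\xrightarrow{\overline{x}\langle y\rangle}S$ then $P\mid Q\xrightarrow{\tau}(\mathsf{pop}\,y)R\mid S$; symmetrically if $P\xrightarrow{\overline{x}\langle y\rangle}R$ and $Q\xrightarrow{\mathsf{in}\,x}S$ then $P\mid Q\xrightarrow{\tau}R\mid(\mathsf{pop}\,y)S$; if $P\xrightarrow{\overline{x+1}\langle 0\rangle}R$ then $\nu P\xrightarrow{\overline{x}\langle\cdot\rangle}R$; if $P\xrightarrow{\mathsf{in}\,x}R$ and $Q\xrightarrow{\overline{x}\langle\cdot\rangle}S$ then $P\mid Q\xrightarrow{\tau}\nu(R\mid S)$; symmetrically if $P\xrightarrow{\overline{x}\langle\cdot\rangle}R$ and $Q\xrightarrow{\mathsf{in}\,x}S$ then $P\mid Q\xrightarrow{\tau}\nu(R\mid S)$; if $P\xrightarrow{\mathsf{push}\,c}R$ then $\nu P\xrightarrow{c}\nu R$; if $P\xrightarrow{\mathsf{push}\,b}R$ then $\nu P\xrightarrow{b}\nu(\mathsf{swap}\,R)$; if $P\mid !P\xrightarrow{a}R$ then $!P\xrightarrow{a}R$.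 Generalised bound braid: for $P,R\in\mathrm{Proc}(\Gamma)$, the relation $P\rtimes R$ is defined inductively by: if $P,R\in\mathrm{Proc}(\Gamma+2)$ and $P=\mathsf{swap}\,R$ then $\nu\nu P\rtimes\nu\nu R$; $\mathbf{0}\rtimes\mathbf{0}$; $\mathsf{in}\,x.P\rtimes\mathsf{in}\,x.P$; $\overline{x}\langle y\rangle.P\rtimes\overline{x}\langle y\rangle.P$; if $P\rtimes R$ then $P+Q\rtimes R+Q$; if $Q\rtimes S$ then $P+Q\rtimes P+S$; if $P\rtimes R$ and $Q\rtimes S$ then $P\mid Q\rtimes R\mid S$; if $P\rtimes R$ then $\nu P\rtimes\nu R$; if $P\rtimes R$ then $!P\rtimes !R$. -}

module Defs where

open import Data.Nat using (ℕ; zero; suc)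
open import Data.Fin using (Fin; zero; suc)
open import Relation.Binary.PropositionalEquality using (_≡_)

-- Contexts are natural numbers; names in Γ are elements of Fin Γ (de Bruijn indices).

data Proc (Γ : ℕ) : Set where
  𝟘    : Proc Γ
  inp  : Fin Γ → Proc (suc Γ) → Proc Γ
  out  : Fin Γ → Fin Γ → Proc Γ → Proc Γ
  _⊕_  : Proc Γ → Proc Γ → Proc Γ
  _∥_  : Proc Γ → Proc Γ → Proc Γ
  ν    : Proc (suc Γ) → Proc Γ
  !_   : Proc Γ → Proc Γ

-- Actions in Γ, indexed by |a| ∈ {0,1}: bound actions have index 1,
-- non-bound actions have index 0.
data Act (Γ : ℕ) : ℕ → Set where
  ainp  : Fin Γ → Act Γ 1
  about : Fin Γ → Act Γ 1            -- x̄⟨·⟩ (bound output)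
  aout  : Fin Γ → Fin Γ → Act Γ 0
  τ     : Act Γ 0

-- Γ + |a|, defined by recursion on the second argument so it reduces.
_+ᶜ_ : ℕ → ℕ → ℕ
Γ +ᶜ zero  = Γ
Γ +ᶜ suc k = suc (Γ +ᶜ k)

Ren : ℕ → ℕ → Set
Ren Γ Δ = Fin Γ → Fin Δ

lift : ∀ {Γ Δ} → Ren Γ Δ → Ren (suc Γ) (suc Δ)
lift ρ zero    = zero
lift ρ (suc x) = suc (ρ x)

ren : ∀ {Γ Δ} → Ren Γ Δ → Proc Γ → Proc Δ
ren ρ 𝟘         = 𝟘
ren ρ (inp x P) = inp (ρ x) (ren (lift ρ) P)
ren ρ (out x y P) = out (ρ x) (ρ y) (ren ρ P)
ren ρ (P ⊕ Q)   = ren ρ P ⊕ ren ρ Q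
ren ρ (P ∥ Q)   = ren ρ P ∥ ren ρ Q
ren ρ (ν P)     = ν (ren (lift ρ) P)
ren ρ (! P)     = ! ren ρ P

renAct : ∀ {Γ Δ k} → Ren Γ Δ → Act Γ k → Act Δ k
renAct ρ (ainp x)   = ainp (ρ x)
renAct ρ (about x)  = about (ρ x)
renAct ρ (aout x y) = aout (ρ x) (ρ y)
renAct ρ τ          = τ

push : ∀ {Γ} → Ren Γ (suc Γ)
push = suc

pop : ∀ {Γ} → Fin Γ → Ren (suc Γ) Γ
pop y zero    = y
pop y (suc x) = x

swap : ∀ {Γ} → Ren (suc (suc Γ)) (suc (suc Γ))
swap zero          = suc zero
swap (suc zero)    = zero
swap (suc (suc x)) = suc (suc x)

data _—[_]→_ {Γ : ℕ} : ∀ {k} → Proc Γ → Act Γ k → Proc (Γ +ᶜ k) → Set where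
  t-inp   : ∀ {x P} → inp x P —[ ainp x ]→ P
  t-out   : ∀ {x y P} → out x y P —[ aout x y ]→ P
  t-sumL  : ∀ {k} {a : Act Γ k} {P Q R} → P —[ a ]→ R → (P ⊕ Q) —[ a ]→ R
  t-sumR  : ∀ {k} {a : Act Γ k} {P Q S} → Q —[ a ]→ S → (P ⊕ Q) —[ a ]→ S
  t-parLc : ∀ {c : Act Γ 0} {P Q R} → P —[ c ]→ R → (P ∥ Q) —[ c ]→ (R ∥ Q)
  t-parRc : ∀ {c : Act Γ 0} {P Q S} → Q —[ c ]→ S → (P ∥ Q) —[ c ]→ (P ∥ S)
  t-parLb : ∀ {b : Act Γ 1} {P Q R} → P —[ b ]→ R → (P ∥ Q) —[ b ]→ (R ∥ ren push Q)
  t-parRb : ∀ {b : Act Γ 1} {P Q S} → Q —[ b ]→ S → (P ∥ Q) —[ b ]→ (ren push P ∥ S)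
  t-commL : ∀ {x y P Q R S} → P —[ ainp x ]→ R → Q —[ aout x y ]→ S
          → (P ∥ Q) —[ τ ]→ (ren (pop y) R ∥ S)
  t-commR : ∀ {x y P Q R S} → P —[ aout x y ]→ R → Q —[ ainp x ]→ S
          → (P ∥ Q) —[ τ ]→ (R ∥ ren (pop y) S)
  t-open  : ∀ {x P R} → P —[ aout (suc x) zero ]→ R → ν P —[ about x ]→ R
  t-closeL : ∀ {x P Q R S} → P —[ ainp x ]→ R → Q —[ about x ]→ S
           → (P ∥ Q) —[ τ ]→ ν (R ∥ S)
  t-closeR : ∀ {x P Q R S} → P —[ about x ]→ R → Q —[ ainp x ]→ S
           → (P ∥ Q) —[ τ ]→ ν (R ∥ S)
  t-resc  : ∀ {c : Act Γ 0} {P R} → P —[ renAct push c ]→ R → ν P —[ c ]→ ν R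
  t-resb  : ∀ {b : Act Γ 1} {P R} → P —[ renAct push b ]→ R → ν P —[ b ]→ ν (ren swap R)
  t-rep   : ∀ {k} {a : Act Γ k} {P R} → (P ∥ (! P)) —[ a ]→ R → (! P) —[ a ]→ R

data _⋊_ : ∀ {Γ} → Proc Γ → Proc Γ → Set where
  br-swap : ∀ {Γ} {P R : Proc (suc (suc Γ))} → P ≡ ren swap R → ν (ν P) ⋊ ν (ν R)
  br-𝟘    : ∀ {Γ} → (𝟘 {Γ}) ⋊ 𝟘
  br-inp  : ∀ {Γ} {x : Fin Γ} {P} → inp x P ⋊ inp x P
  br-out  : ∀ {Γ} {x y : Fin Γ} {P} → out x y P ⋊ out x y P
  br-sumL : ∀ {Γ} {P R Q : Proc Γ} → P ⋊ R → (P ⊕ Q) ⋊ (R ⊕ Q)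
  br-sumR : ∀ {Γ} {P Q S : Proc Γ} → Q ⋊ S → (P ⊕ Q) ⋊ (P ⊕ S)
  br-par  : ∀ {Γ} {P R Q S : Proc Γ} → P ⋊ R → Q ⋊ S → (P ∥ Q) ⋊ (R ∥ S)
  br-ν    : ∀ {Γ} {P R : Proc (suc Γ)} → P ⋊ R → ν P ⋊ ν R
  br-!    : ∀ {Γ} {P R : Proc Γ} → P ⋊ R → (! P) ⋊ (! R)

-- A braid only exchanges two adjacent restrictions, so every transition of P is matched by the
-- same rule at P', with braided residuals.  The only genuine case is νν (swap R) ⋊ νν R: the
-- transition crosses both binders, and renaming its premise by the involution swap yields a
-- premise for νν R, where the two binders are crossed in the opposite order if one of them is
-- opened.  The residuals then differ by a braid, or, when a bound action crosses both binders,
-- by the braid relation between swap and lift swap.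
module Submission where

open import Defs
open import Data.Nat using (ℕ; zero; suc)
open import Data.Fin using (Fin; zero; suc)
open import Data.Product using (Σ; _×_; _,_)
open import Function using (_∘_; id)
open import Relation.Binary.PropositionalEquality
open ≡-Reasoning

lift-cong : ∀ {Γ Δ} {ρ σ : Ren Γ Δ} → ρ ≗ σ → lift ρ ≗ lift σ
lift-cong ρ≗σ zero    = refl
lift-cong ρ≗σ (suc x) = cong suc (ρ≗σ x)

ren-cong : ∀ {Γ Δ} {ρ σ : Ren Γ Δ} → ρ ≗ σ → ∀ P → ren ρ P ≡ ren σ P
ren-cong ρ≗σ 𝟘           = refl
ren-cong ρ≗σ (inp x P)   = cong₂ inp (ρ≗σ x) (ren-cong (lift-cong ρ≗σ) P)
ren-cong ρ≗σ (out x y P) =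
  trans (cong₂ (λ x' y' → out x' y' _) (ρ≗σ x) (ρ≗σ y)) (cong (out _ _) (ren-cong ρ≗σ P))
ren-cong ρ≗σ (P ⊕ Q)     = cong₂ _⊕_ (ren-cong ρ≗σ P) (ren-cong ρ≗σ Q)
ren-cong ρ≗σ (P ∥ Q)     = cong₂ _∥_ (ren-cong ρ≗σ P) (ren-cong ρ≗σ Q)
ren-cong ρ≗σ (ν P)       = cong ν (ren-cong (lift-cong ρ≗σ) P)
ren-cong ρ≗σ (! P)       = cong !_ (ren-cong ρ≗σ P)

lift-∘ : ∀ {Γ Δ Θ} (σ : Ren Δ Θ) (ρ : Ren Γ Δ) → lift σ ∘ lift ρ ≗ lift (σ ∘ ρ)
lift-∘ σ ρ zero    = refl
lift-∘ σ ρ (suc x) = refl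

ren-∘ : ∀ {Γ Δ Θ} (σ : Ren Δ Θ) (ρ : Ren Γ Δ) P → ren σ (ren ρ P) ≡ ren (σ ∘ ρ) P
ren-∘ σ ρ 𝟘           = refl
ren-∘ σ ρ (inp x P)   = cong (inp _) (trans (ren-∘ _ _ P) (ren-cong (lift-∘ σ ρ) P))
ren-∘ σ ρ (out x y P) = cong (out _ _) (ren-∘ σ ρ P)
ren-∘ σ ρ (P ⊕ Q)     = cong₂ _⊕_ (ren-∘ σ ρ P) (ren-∘ σ ρ Q)
ren-∘ σ ρ (P ∥ Q)     = cong₂ _∥_ (ren-∘ σ ρ P) (ren-∘ σ ρ Q)
ren-∘ σ ρ (ν P)       = cong ν (trans (ren-∘ _ _ P) (ren-cong (lift-∘ σ ρ) P))
ren-∘ σ ρ (! P)       = cong !_ (ren-∘ σ ρ P)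

lift-id : ∀ {Γ} {ρ : Ren Γ Γ} → ρ ≗ id → lift ρ ≗ id
lift-id ρ≗id zero    = refl
lift-id ρ≗id (suc x) = cong suc (ρ≗id x)

ren-id : ∀ {Γ} {ρ : Ren Γ Γ} → ρ ≗ id → ∀ P → ren ρ P ≡ P
ren-id ρ≗id 𝟘           = refl
ren-id ρ≗id (inp x P)   = cong₂ inp (ρ≗id x) (ren-id (lift-id ρ≗id) P)
ren-id ρ≗id (out x y P) =
  trans (cong₂ (λ x' y' → out x' y' _) (ρ≗id x) (ρ≗id y)) (cong (out x y) (ren-id ρ≗id P))
ren-id ρ≗id (P ⊕ Q)     = cong₂ _⊕_ (ren-id ρ≗id P) (ren-id ρ≗id Q)
ren-id ρ≗id (P ∥ Q)     = cong₂ _∥_ (ren-id ρ≗id P) (ren-id ρ≗id Q)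
ren-id ρ≗id (ν P)       = cong ν (ren-id (lift-id ρ≗id) P)
ren-id ρ≗id (! P)       = cong !_ (ren-id ρ≗id P)

ren-square : ∀ {Γ Δ Δ' Θ} {σ : Ren Δ Θ} {ρ : Ren Γ Δ} {σ' : Ren Δ' Θ} {ρ' : Ren Γ Δ'}
  → σ ∘ ρ ≗ σ' ∘ ρ' → ∀ P → ren σ (ren ρ P) ≡ ren σ' (ren ρ' P)
ren-square {σ = σ} {ρ} {σ'} {ρ'} square P = begin
  ren σ (ren ρ P)    ≡⟨ ren-∘ σ ρ P ⟩
  ren (σ ∘ ρ) P      ≡⟨ ren-cong square P ⟩
  ren (σ' ∘ ρ') P    ≡⟨ ren-∘ σ' ρ' P ⟨
  ren σ' (ren ρ' P)  ∎

swap-involutive : ∀ {Γ} → swap {Γ} ∘ swap ≗ id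
swap-involutive zero          = refl
swap-involutive (suc zero)    = refl
swap-involutive (suc (suc x)) = refl

ren-swap-involutive : ∀ {Γ} (P : Proc (suc (suc Γ))) → ren swap (ren swap P) ≡ P
ren-swap-involutive P = trans (ren-∘ swap swap P) (ren-id swap-involutive P)

swap-natural : ∀ {Γ Δ} (ρ : Ren Γ Δ) → lift (lift ρ) ∘ swap ≗ swap ∘ lift (lift ρ)
swap-natural ρ zero          = refl
swap-natural ρ (suc zero)    = refl
swap-natural ρ (suc (suc x)) = refl

pop-natural : ∀ {Γ Δ} (ρ : Ren Γ Δ) (y : Fin Γ) → pop (ρ y) ∘ lift ρ ≗ ρ ∘ pop y
pop-natural ρ y zero    = refl
pop-natural ρ y (suc x) = refl

swap-braid : ∀ {Γ} → lift swap ∘ swap ≗ swap ∘ lift swap ∘ swap ∘ lift (swap {Γ})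
swap-braid zero                = refl
swap-braid (suc zero)          = refl
swap-braid (suc (suc zero))    = refl
swap-braid (suc (suc (suc x))) = refl

ren-swap-braid : ∀ {Γ} (P : Proc (suc (suc (suc Γ)))) →
  ren (lift swap) (ren swap P) ≡ ren swap (ren (lift swap) (ren swap (ren (lift swap) P)))
ren-swap-braid P = begin
  ren (lift swap) (ren swap P)                               ≡⟨ ren-∘ _ _ P ⟩
  ren (lift swap ∘ swap) P                                   ≡⟨ ren-cong swap-braid P ⟩
  ren (swap ∘ lift swap ∘ swap ∘ lift swap) P                ≡⟨ ren-∘ _ _ P ⟨
  ren swap (ren (lift swap ∘ swap ∘ lift swap) P)            ≡⟨ cong (ren swap) (ren-∘ _ _ P) ⟨
  ren swap (ren (lift swap) (ren (swap ∘ lift swap) P))      ≡⟨ cong (ren swap ∘ ren (lift swap)) (ren-∘ _ _ P) ⟨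
  ren swap (ren (lift swap) (ren swap (ren (lift swap) P)))  ∎

≡-target : ∀ {Γ k} {P : Proc Γ} {a : Act Γ k} {R S} → R ≡ S → P —[ a ]→ R → P —[ a ]→ S
≡-target refl d = d

liftⁿ : ∀ {Γ Δ} k → Ren Γ Δ → Ren (Γ +ᶜ k) (Δ +ᶜ k)
liftⁿ zero    ρ = ρ
liftⁿ (suc k) ρ = lift (liftⁿ k ρ)

ren-—→ : ∀ {Γ Δ k} (ρ : Ren Γ Δ) {P : Proc Γ} {a : Act Γ k} {R}
  → P —[ a ]→ R → ren ρ P —[ renAct ρ a ]→ ren (liftⁿ k ρ) R
ren-—→ ρ t-inp          = t-inp
ren-—→ ρ t-out          = t-out
ren-—→ ρ (t-sumL d)     = t-sumL (ren-—→ ρ d)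
ren-—→ ρ (t-sumR d)     = t-sumR (ren-—→ ρ d)
ren-—→ ρ (t-parLc d)    = t-parLc (ren-—→ ρ d)
ren-—→ ρ (t-parRc d)    = t-parRc (ren-—→ ρ d)
ren-—→ ρ (t-parLb {Q = Q} d) =
  ≡-target (cong (_ ∥_) (ren-square (λ _ → refl) Q)) (t-parLb (ren-—→ ρ d))
ren-—→ ρ (t-parRb {P = P} d) =
  ≡-target (cong (_∥ _) (ren-square (λ _ → refl) P)) (t-parRb (ren-—→ ρ d))
ren-—→ ρ (t-commL {y = y} {R = R} d e) =
  ≡-target (cong (_∥ _) (ren-square (pop-natural ρ y) R)) (t-commL (ren-—→ ρ d) (ren-—→ ρ e))
ren-—→ ρ (t-commR {y = y} {S = S} d e) =
  ≡-target (cong (_ ∥_) (ren-square (pop-natural ρ y) S)) (t-commR (ren-—→ ρ d) (ren-—→ ρ e))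
ren-—→ ρ (t-open d)     = t-open (ren-—→ (lift ρ) d)
ren-—→ ρ (t-closeL d e) = t-closeL (ren-—→ ρ d) (ren-—→ ρ e)
ren-—→ ρ (t-closeR d e) = t-closeR (ren-—→ ρ d) (ren-—→ ρ e)
ren-—→ ρ (t-resc {c = aout x y} d) = t-resc (ren-—→ (lift ρ) d)
ren-—→ ρ (t-resc {c = τ} d)        = t-resc (ren-—→ (lift ρ) d)
ren-—→ ρ (t-resb {b = ainp x} {R = R} d) =
  ≡-target (cong ν (sym (ren-square (swap-natural ρ) R))) (t-resb (ren-—→ (lift ρ) d))
ren-—→ ρ (t-resb {b = about x} {R = R} d) =
  ≡-target (cong ν (sym (ren-square (swap-natural ρ) R))) (t-resb (ren-—→ (lift ρ) d))
ren-—→ ρ (t-rep d)      = t-rep (ren-—→ ρ d)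

unswap-—→ : ∀ {Γ k} {P : Proc (suc (suc Γ))} {a : Act (suc (suc Γ)) k} {R}
  → ren swap P —[ a ]→ R → P —[ renAct swap a ]→ ren (liftⁿ k swap) R
unswap-—→ {P = P} d = subst (λ X → X —[ _ ]→ _) (ren-swap-involutive P) (ren-—→ swap d)

⋊-refl : ∀ {Γ} (P : Proc Γ) → P ⋊ P
⋊-refl 𝟘           = br-𝟘
⋊-refl (inp x P)   = br-inp
⋊-refl (out x y P) = br-out
⋊-refl (P ⊕ Q)     = br-sumL (⋊-refl P)
⋊-refl (P ∥ Q)     = br-par (⋊-refl P) (⋊-refl Q)
⋊-refl (ν P)       = br-ν (⋊-refl P)
⋊-refl (! P)       = br-! (⋊-refl P)

ren-⋊ : ∀ {Γ Δ} (ρ : Ren Γ Δ) {P R : Proc Γ} → P ⋊ R → ren ρ P ⋊ ren ρ R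
ren-⋊ ρ (br-swap {R = R} refl) = br-swap (ren-square (swap-natural ρ) R)
ren-⋊ ρ br-𝟘                   = br-𝟘
ren-⋊ ρ br-inp                 = br-inp
ren-⋊ ρ br-out                 = br-out
ren-⋊ ρ (br-sumL b)            = br-sumL (ren-⋊ ρ b)
ren-⋊ ρ (br-sumR b)            = br-sumR (ren-⋊ ρ b)
ren-⋊ ρ (br-par b c)           = br-par (ren-⋊ ρ b) (ren-⋊ ρ c)
ren-⋊ ρ (br-ν b)               = br-ν (ren-⋊ (lift ρ) b)
ren-⋊ ρ (br-! b)               = br-! (ren-⋊ ρ b)

_⋊—[_]→_ : ∀ {Γ k} → Proc Γ → Act Γ k → Proc (Γ +ᶜ k) → Set
_⋊—[_]→_ {Γ} {k} P' a R = Σ (Proc (Γ +ᶜ k)) (λ R' → (P' —[ a ]→ R') × (R ⋊ R'))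

νν-swap-simulation : ∀ {Γ k} {P : Proc (suc (suc Γ))} {a : Act Γ k} {R}
  → ν (ν (ren swap P)) —[ a ]→ R → ν (ν P) ⋊—[ a ]→ R
νν-swap-simulation (t-open (t-resc {c = aout (suc x) zero} {R = R} d)) =
  ν (ren swap (ren swap R)) , t-resb {b = about x} (t-open (unswap-—→ d)) ,
  subst (λ X → ν R ⋊ ν X) (sym (ren-swap-involutive R)) (⋊-refl _)
νν-swap-simulation (t-resc {c = aout x y} (t-resc {R = R} d)) =
  ν (ν (ren swap R)) , t-resc (t-resc (unswap-—→ d)) , br-swap (sym (ren-swap-involutive R))
νν-swap-simulation (t-resc {c = τ} (t-resc {R = R} d)) =
  ν (ν (ren swap R)) , t-resc (t-resc (unswap-—→ d)) , br-swap (sym (ren-swap-involutive R))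
νν-swap-simulation (t-resb {b = ainp x} (t-resb {R = R} d)) =
  _ , t-resb (t-resb (unswap-—→ d)) , br-swap (ren-swap-braid R)
νν-swap-simulation (t-resb {b = about x} (t-resb {R = R} d)) =
  _ , t-resb (t-resb (unswap-—→ d)) , br-swap (ren-swap-braid R)
νν-swap-simulation (t-resb {b = about x} (t-open {R = R} d)) =
  ν (ren swap R) , t-open (t-resc {c = aout (suc x) zero} (unswap-—→ d)) , ⋊-refl _

⋊-simulation : ∀ {Γ k} {P P' : Proc Γ} {a : Act Γ k} {R}
  → P —[ a ]→ R → P ⋊ P' → P' ⋊—[ a ]→ R
⋊-simulation d (br-swap refl) = νν-swap-simulation d
⋊-simulation () br-𝟘
⋊-simulation d br-inp = _ , d , ⋊-refl _
⋊-simulation d br-out = _ , d , ⋊-refl _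
⋊-simulation (t-sumL d) (br-sumL b) with ⋊-simulation d b
... | R' , d' , b' = R' , t-sumL d' , b'
⋊-simulation (t-sumR d) (br-sumL b) = _ , t-sumR d , ⋊-refl _
⋊-simulation (t-sumL d) (br-sumR b) = _ , t-sumL d , ⋊-refl _
⋊-simulation (t-sumR d) (br-sumR b) with ⋊-simulation d b
... | R' , d' , b' = R' , t-sumR d' , b'
⋊-simulation (t-parLc d) (br-par b c) with ⋊-simulation d b
... | _ , d' , b' = _ , t-parLc d' , br-par b' c
⋊-simulation (t-parRc d) (br-par b c) with ⋊-simulation d c
... | _ , d' , c' = _ , t-parRc d' , br-par b c'
⋊-simulation (t-parLb d) (br-par b c) with ⋊-simulation d b
... | _ , d' , b' = _ , t-parLb d' , br-par b' (ren-⋊ push c)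
⋊-simulation (t-parRb d) (br-par b c) with ⋊-simulation d c
... | _ , d' , c' = _ , t-parRb d' , br-par (ren-⋊ push b) c'
⋊-simulation (t-commL {y = y} d e) (br-par b c) with ⋊-simulation d b | ⋊-simulation e c
... | _ , d' , b' | _ , e' , c' = _ , t-commL d' e' , br-par (ren-⋊ (pop y) b') c'
⋊-simulation (t-commR {y = y} d e) (br-par b c) with ⋊-simulation d b | ⋊-simulation e c
... | _ , d' , b' | _ , e' , c' = _ , t-commR d' e' , br-par b' (ren-⋊ (pop y) c')
⋊-simulation (t-closeL d e) (br-par b c) with ⋊-simulation d b | ⋊-simulation e c
... | _ , d' , b' | _ , e' , c' = _ , t-closeL d' e' , br-ν (br-par b' c')
⋊-simulation (t-closeR d e) (br-par b c) with ⋊-simulation d b | ⋊-simulation e c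
... | _ , d' , b' | _ , e' , c' = _ , t-closeR d' e' , br-ν (br-par b' c')
⋊-simulation (t-open d) (br-ν b) with ⋊-simulation d b
... | _ , d' , b' = _ , t-open d' , b'
⋊-simulation (t-resc d) (br-ν b) with ⋊-simulation d b
... | _ , d' , b' = _ , t-resc d' , br-ν b'
⋊-simulation (t-resb d) (br-ν b) with ⋊-simulation d b
... | _ , d' , b' = _ , t-resb d' , br-ν (ren-⋊ swap b')
⋊-simulation (t-rep d) (br-! b) with ⋊-simulation d (br-par b (br-! b))
... | _ , d' , b' = _ , t-rep d' , b'

theorem4p5 : ∀ {Γ k} {P P' : Proc Γ} {a : Act Γ k} {R : Proc (Γ +ᶜ k)}
    → P —[ a ]→ R → P ⋊ P'
    → Σ (Proc (Γ +ᶜ k)) (λ R' → (P' —[ a ]→ R') × (R ⋊ R'))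
theorem4p5 = ⋊-simulation
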